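{- Let $G$ be a $3$-edge-connected graph and $v$ a vertex of degree $3$. If $G_v$ is a local cubic modification of $G$ at $v$, then $F(G_v)\le F(G)$.
   Context: Graphs are finite and simple. For a vertex $v$ of degree $3$ with neighbours $x_1,x_2,x_3$, a local cubic modification of $G$ at $v$ is a graph $G_v$ obtained by deleting $v$, adding a triangle on new vertices $v_1,v_2,v_3$, and adding a perfect matching between $\{x_1,x_2,x_3\}$ and $\{v_1,v_2,v_3\}$. An orientation of a graph replaces each edge $uv$ by exactly one of the arcs $(u,v)$, $(v,u)$. An oriented graph is strongly connected if for any two vertices $x,y$ there is a directed $(x,y)$-path. In an orientation $O$ of $G$, an edge $e$ is deletable if $O-e$ is strongly connected. For a $3$-edge-connected graph $G$, the Frank number $F(G)$ is the minimum $k$ such that $G$ admits $k$ orientations with the property that every edge of $G$ is deletable in at least one of them. -}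

module Defs where

open import Data.Nat using (ℕ; zero; suc; _+_; _<_)
open import Data.Fin using (Fin; zero; suc; _≟_)
open import Data.Fin.Base using (toℕ)
open import Data.Bool using (Bool; true; false; _∧_; _∨_; not)
open import Data.List using (List; length; filterᵇ; allFin)
open import Data.Product using (Σ; ∃; _×_)
open import Data.Sum using (_⊎_)
open import Relation.Nullary using (¬_)
open import Relation.Nullary.Decidable using (⌊_⌋)
open import Relation.Binary.PropositionalEquality using (_≡_)

Graph : ℕ → Set
Graph n = Fin n → Fin n → Bool

record IsSimple {n : ℕ} (G : Graph n) : Set where
  field
    sym   : ∀ u w → G u w ≡ G w u
    loopless : ∀ u → G u u ≡ false

degree : ∀ {n} → Graph n → Fin n → ℕ
degree {n} G v = length (filterᵇ (G v) (allFin n))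

data Reach {n : ℕ} (A : Fin n → Fin n → Bool) : Fin n → Fin n → Set where
  here : ∀ {x} → Reach A x x
  step : ∀ {x y z} → A x y ≡ true → Reach A y z → Reach A x z

delEdge : ∀ {n} → (Fin n → Fin n → Bool) → Fin n → Fin n → (Fin n → Fin n → Bool)
delEdge A a b u w =
  A u w ∧ not ((⌊ u ≟ a ⌋ ∧ ⌊ w ≟ b ⌋) ∨ (⌊ u ≟ b ⌋ ∧ ⌊ w ≟ a ⌋))

-- Connected graph (for a symmetric adjacency, reachability = connectivity).
Connected : ∀ {n} → Graph n → Set
Connected G = ∀ x y → Reach G x y

-- 3-edge-connected: connected after deleting any at most two edges
-- (deleting a non-edge or the same edge twice covers fewer than two deletions).
ThreeEdgeConnected : ∀ {n} → Graph n → Set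
ThreeEdgeConnected G = ∀ a b c d → Connected (delEdge (delEdge G a b) c d)

record Orientation {n : ℕ} (G : Graph n) : Set where
  field
    arc     : Fin n → Fin n → Bool
    arc⊆G   : ∀ u w → arc u w ≡ true → G u w ≡ true
    exactly : ∀ u w → G u w ≡ true →
              (arc u w ≡ true × arc w u ≡ false) ⊎ (arc u w ≡ false × arc w u ≡ true)
open Orientation public

StronglyConnected : ∀ {n} → (Fin n → Fin n → Bool) → Set
StronglyConnected A = ∀ x y → Reach A x y

Deletable : ∀ {n} {G : Graph n} → Orientation G → Fin n → Fin n → Set
Deletable O u w = StronglyConnected (delEdge (arc O) u w)

Admits : ∀ {n} → Graph n → ℕ → Set
Admits {n} G k =
  Σ (Fin k → Orientation G) λ Os →
    ∀ u w → G u w ≡ true → ∃ λ (i : Fin k) → Deletable (Os i) u w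

IsFrankNumber : ∀ {n} → Graph n → ℕ → Set
IsFrankNumber G k = Admits G k × (∀ j → j < k → ¬ Admits G j)

-- Vertex set Fin (2 + n): suc (suc u) is the old vertex u, where the old v
-- plays the role of the new vertex v1; zero is v2 and suc zero is v3.
-- Triangle v1v2v3, matching x1–v1, x2–v2, x3–v3; v is deleted.
localCubicMod : ∀ {n} → Graph n → (v x1 x2 x3 : Fin n) → Graph (suc (suc n))
localCubicMod G v x1 x2 x3 = H
  where
  is : ∀ {m} → Fin m → Fin m → Bool
  is a b = ⌊ a ≟ b ⌋
  old : Fin _ → Fin _ → Bool
  old a b with is a v | is b v
  ... | true  | true  = false
  ... | true  | false = is b x1
  ... | false | true  = is a x1
  ... | false | false = G a b
  H : Graph _
  H zero zero = false
  H zero (suc zero) = true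
  H (suc zero) zero = true
  H (suc zero) (suc zero) = false
  H zero (suc (suc b)) = is b v ∨ is b x2
  H (suc (suc a)) zero = is a v ∨ is a x2
  H (suc zero) (suc (suc b)) = is b v ∨ is b x3
  H (suc (suc a)) (suc zero) = is a v ∨ is a x3
  H (suc (suc a)) (suc (suc b)) = old a b

module Submission where

-- Each orientation O of G lifts to G_v: old edges keep their direction, the spoke x_t v_t is
-- directed like x_t v, and the triangle v₁v₂v₃ receives a tournament. Call v_t an entry if
-- x_t → v and an exit if v → x_t. If in the tournament every entry reaches every exit, every
-- corner is reached from an entry and every corner reaches an exit, then each directed path
-- through v can be rerouted through the triangle, so strong connectivity of O − e transfers to
-- the lift minus the edge corresponding to e; deleting a triangle edge is handled in the same
-- way. Hence k orientations covering the edges of G give k orientations covering the old edges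
-- and the spokes of G_v, and the tournaments have to be chosen so that the triangle edges are
-- covered as well.
-- As v has degree 3, if the spoke x_r v is deletable in O then x_r lies on the side of v that
-- carries two of its three arcs. The transitive tournament with v_r in the middle then serves
-- the old edges and the spoke at v_r, and frees both triangle edges other than v_r v_m, where
-- v_m is the corner on the other side. If the three spokes are deletable in three different
-- orientations, each triangle edge is freed in the orientation of the opposite spoke. The three
-- spokes are never all deletable in one orientation; if exactly two of them are, that
-- orientation gets a directed triangle, which serves both spokes and frees the one triangle
-- edge left. The finitely many configurations of the triangle are checked by evaluation.

open import Defs
open import Data.Nat using (ℕ; zero; suc; _≤_; _<_; s≤s)
open import Data.Nat.Properties using (≤-refl; ≮⇒≥)
open import Data.Fin using (Fin; zero; suc; _≟_) renaming (_<_ to _<ᶠ_)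
open import Data.Fin.Properties using (pigeonhole; any?)
open import Data.Bool using (Bool; true; false; _∧_; _∨_; not; _xor_; if_then_else_; T)
open import Data.Bool.Properties using (∧-identityʳ; ∧-zeroʳ; ∨-comm; ∧-conicalˡ; ∧-conicalʳ)
open import Data.List using (length; filterᵇ; allFin)
open import Data.List.Relation.Unary.Any using (index)
open import Data.List.Membership.Propositional using (_∈_)
open import Data.List.Membership.Propositional.Properties using (∈-filter⁺; ∈-allFin)
open import Data.List.Membership.Setoid.Properties using (index-injective)
open import Data.Vec using (Vec; []; _∷_; lookup)
open import Data.Vec.Relation.Unary.All using ([]; _∷_)
open import Data.Vec.Relation.Unary.All.Properties using (lookup⁺)
open import Data.Product using (∃; ∃₂; _×_; _,_; proj₁; proj₂)
open import Data.Sum using (_⊎_; inj₁; inj₂)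
open import Data.Empty using (⊥; ⊥-elim)
open import Function using (id; _∘_)
open import Relation.Nullary using (¬_; Dec; yes; no)
open import Relation.Nullary.Decidable using (⌊_⌋; recompute; ¬?)
open import Relation.Binary.PropositionalEquality using (_≡_; _≢_; refl; sym; trans; cong; cong₂; subst; setoid)

-- Arc relations and reachability

Arcs : ℕ → Set
Arcs m = Fin m → Fin m → Bool

infix 4 _⊆ᵃ_
_⊆ᵃ_ : ∀ {m} → Arcs m → Arcs m → Set
A ⊆ᵃ B = ∀ u w → A u w ≡ true → B u w ≡ true

⊆ᵃ-refl : ∀ {m} {A : Arcs m} → A ⊆ᵃ A
⊆ᵃ-refl _ _ e = e

⊆ᵃ-trans : ∀ {m} {A B C : Arcs m} → A ⊆ᵃ B → B ⊆ᵃ C → A ⊆ᵃ C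
⊆ᵃ-trans A⊆B B⊆C u w = B⊆C u w ∘ A⊆B u w

∧-intro : ∀ {a b} → a ≡ true → b ≡ true → a ∧ b ≡ true
∧-intro refl refl = refl

module _ {m : ℕ} {A : Arcs m} where

  reach-trans : ∀ {x y z} → Reach A x y → Reach A y z → Reach A x z
  reach-trans here       r = r
  reach-trans (step a p) r = step a (reach-trans p r)

  step-arc-into : ∀ {x y z} → A x y ≡ true → Reach A y z → ∃ λ w → A w z ≡ true
  step-arc-into a here       = _ , a
  step-arc-into _ (step a p) = step-arc-into a p

  reach-arc-into : ∀ {x y} → Reach A x y → x ≢ y → ∃ λ w → A w y ≡ true
  reach-arc-into here       x≢y = ⊥-elim (x≢y refl)
  reach-arc-into (step a p) _   = step-arc-into a p

  reach-arc-out-of : ∀ {x y} → Reach A x y → x ≢ y → ∃ λ w → A x w ≡ true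
  reach-arc-out-of here       x≢y = ⊥-elim (x≢y refl)
  reach-arc-out-of (step a _) _   = _ , a

reach-map : ∀ {m m′} {A : Arcs m} {B : Arcs m′} (f : Fin m → Fin m′) →
            (∀ {u w} → A u w ≡ true → B (f u) (f w) ≡ true) →
            ∀ {x y} → Reach A x y → Reach B (f x) (f y)
reach-map f preserves here       = here
reach-map f preserves (step a p) = step (preserves a) (reach-map f preserves p)

strongly-connected-mono : ∀ {m} {A B : Arcs m} → A ⊆ᵃ B → StronglyConnected A → StronglyConnected B
strongly-connected-mono A⊆B sc x y = reach-map id (A⊆B _ _) (sc x y)

≟-both-false : ∀ {m} {u w c d : Fin m} → ¬ (u ≡ c × w ≡ d) → ⌊ u ≟ c ⌋ ∧ ⌊ w ≟ d ⌋ ≡ false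
≟-both-false {u = u} {w} {c} {d} ne with u ≟ c | w ≟ d
... | yes p | yes q = ⊥-elim (ne (p , q))
... | yes _ | no _  = refl
... | no _  | _     = refl

module _ {m : ℕ} {A : Arcs m} {a b : Fin m} where

  delEdge-⊆ : delEdge A a b ⊆ᵃ A
  delEdge-⊆ u w e with A u w
  ... | true = refl

  delEdge-comm : ∀ u w → delEdge A a b u w ≡ delEdge A b a u w
  delEdge-comm u w = cong (λ z → A u w ∧ not z) (∨-comm (⌊ u ≟ a ⌋ ∧ ⌊ w ≟ b ⌋) _)

  delEdge-deletes : delEdge A a b a b ≡ false
  delEdge-deletes with a ≟ a | b ≟ b
  ... | yes _  | yes _  = ∧-zeroʳ (A a b)
  ... | no a≢a | _      = ⊥-elim (a≢a refl)
  ... | _      | no b≢b = ⊥-elim (b≢b refl)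

  delEdge-keeps : ∀ {u w} → ¬ (u ≡ a × w ≡ b) → ¬ (u ≡ b × w ≡ a) → delEdge A a b u w ≡ A u w
  delEdge-keeps {u} {w} ¬ab ¬ba rewrite ≟-both-false ¬ab | ≟-both-false ¬ba = ∧-identityʳ (A u w)

  delEdge-⊇ : ∀ {A′ : Arcs m} → A′ ⊆ᵃ A → A′ a b ≡ false → A′ b a ≡ false → A′ ⊆ᵃ delEdge A a b
  delEdge-⊇ {A′} A′⊆A ab∉ ba∉ u w e = trans (delEdge-keeps (absent ab∉) (absent ba∉)) (A′⊆A u w e)
    where
    absent : ∀ {c d} → A′ c d ≡ false → ¬ (u ≡ c × w ≡ d)
    absent c∉ (refl , refl) with () ← trans (sym e) c∉

delEdge-deletes-reversed : ∀ {m} {A : Arcs m} {a b} → delEdge A a b b a ≡ false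
delEdge-deletes-reversed {A = A} {a} {b} = trans (delEdge-comm {A = A} b a) (delEdge-deletes {A = A} {b} {a})

delEdge-strongly-connected-comm : ∀ {m} {A : Arcs m} {a b} →
  StronglyConnected (delEdge A a b) → StronglyConnected (delEdge A b a)
delEdge-strongly-connected-comm {A = A} {a} {b} =
  strongly-connected-mono λ u w e → trans (sym (delEdge-comm {A = A} {a} {b} u w)) e

-- Vertices of degree three

filter-collide : ∀ {n k} (p : Fin n → Bool) (ys : Fin k → Fin n) →
                 length (filterᵇ p (allFin n)) < k → (∀ i → p (ys i) ≡ true) →
                 ∃₂ λ i j → i <ᶠ j × ys i ≡ ys j
filter-collide p ys short pys =
  let i , j , i<j , same = pigeonhole short (λ i → index (member i))
  in  i , j , i<j , index-injective (setoid _) (member i) (member j) same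
  where
  member : ∀ i → ys i ∈ filterᵇ p (allFin _)
  member i = ∈-filter⁺ _ (∈-allFin (ys i)) (subst T (sym (pys i)) _)

degree-3-neighbours : ∀ {n} (G : Graph n) {v x₁ x₂ x₃ : Fin n} → degree G v ≡ 3 →
  G v x₁ ≡ true → G v x₂ ≡ true → G v x₃ ≡ true → x₁ ≢ x₂ → x₁ ≢ x₃ → x₂ ≢ x₃ →
  ∀ {w} → G v w ≡ true → ∃ λ t → w ≡ lookup (x₁ ∷ x₂ ∷ x₃ ∷ []) t
degree-3-neighbours {n} G {v} {x₁} {x₂} {x₃} deg g₁ g₂ g₃ x₁≢x₂ x₁≢x₃ x₂≢x₃ {w} g
  with w ≟ x₁ | w ≟ x₂ | w ≟ x₃
... | yes p   | _       | _       = zero , p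
... | no _    | yes p   | _       = suc zero , p
... | no _    | no _    | yes p   = suc (suc zero) , p
... | no w≢x₁ | no w≢x₂ | no w≢x₃ =
  let _ , _ , i<j , same = filter-collide (G v) ys (subst (_< 4) (sym deg) ≤-refl)
                                      (lookup⁺ {P = λ u → G v u ≡ true} (g₁ ∷ g₂ ∷ g₃ ∷ g ∷ []))
  in  ⊥-elim (distinct i<j same)
  where
  ys : Fin 4 → Fin n
  ys = lookup (x₁ ∷ x₂ ∷ x₃ ∷ w ∷ [])
  distinct : ∀ {i j} → i <ᶠ j → ys i ≢ ys j
  distinct {zero}           {suc zero}             _ = x₁≢x₂
  distinct {zero}           {suc (suc zero)}       _ = x₁≢x₃
  distinct {zero}           {suc (suc (suc zero))} _ = w≢x₁ ∘ sym
  distinct {suc zero}       {suc (suc zero)}       _ = x₂≢x₃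
  distinct {suc zero}       {suc (suc (suc zero))} _ = w≢x₂ ∘ sym
  distinct {suc (suc zero)} {suc (suc (suc zero))} _ = w≢x₃ ∘ sym
  distinct {suc zero}             {suc zero}             (s≤s ())
  distinct {suc (suc zero)}       {suc zero}             (s≤s ())
  distinct {suc (suc zero)}       {suc (suc zero)}       (s≤s (s≤s ()))
  distinct {suc (suc (suc zero))} {suc (suc (suc zero))} (s≤s (s≤s (s≤s ())))

distinct⇒injective₃ : ∀ {A : Set} (f : Fin 3 → A) →
  f zero ≢ f (suc zero) → f zero ≢ f (suc (suc zero)) → f (suc zero) ≢ f (suc (suc zero)) →
  ∀ {t s} → f t ≡ f s → t ≡ s
distinct⇒injective₃ f n₀₁ n₀₂ n₁₂ {zero}           {zero}           _ = refl
distinct⇒injective₃ f n₀₁ n₀₂ n₁₂ {zero}           {suc zero}       e = ⊥-elim (n₀₁ e)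
distinct⇒injective₃ f n₀₁ n₀₂ n₁₂ {zero}           {suc (suc zero)} e = ⊥-elim (n₀₂ e)
distinct⇒injective₃ f n₀₁ n₀₂ n₁₂ {suc zero}       {zero}           e = ⊥-elim (n₀₁ (sym e))
distinct⇒injective₃ f n₀₁ n₀₂ n₁₂ {suc zero}       {suc zero}       _ = refl
distinct⇒injective₃ f n₀₁ n₀₂ n₁₂ {suc zero}       {suc (suc zero)} e = ⊥-elim (n₁₂ e)
distinct⇒injective₃ f n₀₁ n₀₂ n₁₂ {suc (suc zero)} {zero}           e = ⊥-elim (n₀₂ (sym e))
distinct⇒injective₃ f n₀₁ n₀₂ n₁₂ {suc (suc zero)} {suc zero}       e = ⊥-elim (n₁₂ (sym e))
distinct⇒injective₃ f n₀₁ n₀₂ n₁₂ {suc (suc zero)} {suc (suc zero)} _ = refl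

-- Finite checks on the triangle

infix 7 _==_
_==_ : ∀ {m} → Fin m → Fin m → Bool
t == s = ⌊ t ≟ s ⌋

==⇒≡ : ∀ {m} {t s : Fin m} → (t == s) ≡ true → t ≡ s
==⇒≡ {t = t} {s} e with t ≟ s | e
... | yes t≡s | _ = t≡s

==-refl : ∀ {m} (t : Fin m) → (t == t) ≡ true
==-refl t with t ≟ t
... | yes _  = refl
... | no t≢t = ⊥-elim (t≢t refl)

==-≢ : ∀ {m} {t s : Fin m} → t ≢ s → (t == s) ≡ false
==-≢ {t = t} {s} t≢s with t ≟ s
... | yes t≡s = ⊥-elim (t≢s t≡s)
... | no _    = refl

infixr 4 _⇒_
_⇒_ : Bool → Bool → Bool
a ⇒ b = not a ∨ b

⇒-mp : ∀ {a b} → (a ⇒ b) ≡ true → a ≡ true → b ≡ true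
⇒-mp e refl = e

allᶜ someᶜ : (Fin 3 → Bool) → Bool
allᶜ f = f zero ∧ f (suc zero) ∧ f (suc (suc zero))
someᶜ f = f zero ∨ f (suc zero) ∨ f (suc (suc zero))

allᶜ-sound : ∀ f → allᶜ f ≡ true → ∀ t → f t ≡ true
allᶜ-sound f e zero             = ∧-conicalˡ (f zero) _ e
allᶜ-sound f e (suc zero)       = ∧-conicalˡ (f (suc zero)) _ (∧-conicalʳ (f zero) _ e)
allᶜ-sound f e (suc (suc zero)) = ∧-conicalʳ (f (suc zero)) _ (∧-conicalʳ (f zero) _ e)

someᶜ-sound : ∀ f → someᶜ f ≡ true → ∃ λ t → f t ≡ true
someᶜ-sound f e with f zero in f₀ | f (suc zero) in f₁
... | true  | _     = zero , f₀
... | false | true  = suc zero , f₁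
... | false | false = suc (suc zero) , e

someᶜ-intro : ∀ f {t} → f t ≡ true → someᶜ f ≡ true
someᶜ-intro f {zero} e rewrite e = refl
someᶜ-intro f {suc zero} e rewrite e with f zero
... | true  = refl
... | false = refl
someᶜ-intro f {suc (suc zero)} e rewrite e with f zero | f (suc zero)
... | true  | _     = refl
... | false | true  = refl
... | false | false = refl

someᶜ-cong : ∀ {f g} → (∀ t → f t ≡ g t) → someᶜ f ≡ someᶜ g
someᶜ-cong f≗g rewrite f≗g zero | f≗g (suc zero) | f≗g (suc (suc zero)) = refl

-- Entry t of the pattern of an orientation is true iff v → x_t, that is, iff v_t is an exit.
Pattern : Set
Pattern = Vec Bool 3

allᵇ : (Bool → Bool) → Bool
allᵇ f = f true ∧ f false

allᵇ-sound : ∀ f → allᵇ f ≡ true → ∀ b → f b ≡ true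
allᵇ-sound f e true  = ∧-conicalˡ (f true) _ e
allᵇ-sound f e false = ∧-conicalʳ (f true) _ e

allᵖ : (Pattern → Bool) → Bool
allᵖ P = allᵇ λ a → allᵇ λ b → allᵇ λ c → P (a ∷ b ∷ c ∷ [])

exhaustive₁ : (P : Pattern → Bool) → allᵖ P ≡ true → ∀ d → P d ≡ true
exhaustive₁ P e (a ∷ b ∷ c ∷ []) =
  allᵇ-sound (λ c → P (a ∷ b ∷ c ∷ []))
    (allᵇ-sound (λ b → allᵇ λ c → P (a ∷ b ∷ c ∷ []))
      (allᵇ-sound (λ a → allᵇ λ b → allᵇ λ c → P (a ∷ b ∷ c ∷ [])) e a) b) c

exhaustive₂ : (P : Pattern → Fin 3 → Bool) → allᵖ (λ d → allᶜ (P d)) ≡ true → ∀ d r → P d r ≡ true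
exhaustive₂ P e d = allᶜ-sound (P d) (exhaustive₁ (λ d → allᶜ (P d)) e d)

exhaustive₃ : (P : Pattern → Fin 3 → Fin 3 → Bool) →
              allᵖ (λ d → allᶜ λ r → allᶜ (P d r)) ≡ true → ∀ d r s → P d r s ≡ true
exhaustive₃ P e d r = allᶜ-sound (P d r) (exhaustive₂ (λ d r → allᶜ (P d r)) e d r)

exhaustive₄ : (P : Pattern → Fin 3 → Fin 3 → Fin 3 → Bool) →
              allᵖ (λ d → allᶜ λ r → allᶜ λ s → allᶜ (P d r s)) ≡ true → ∀ d r s t → P d r s t ≡ true
exhaustive₄ P e d r s = allᶜ-sound (P d r s) (exhaustive₃ (λ d r s → allᶜ (P d r s)) e d r s)

exhaustive₅ : (P : Pattern → Fin 3 → Fin 3 → Fin 3 → Fin 3 → Bool) →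
              allᵖ (λ d → allᶜ λ r → allᶜ λ s → allᶜ λ t → allᶜ (P d r s t)) ≡ true →
              ∀ d r s t u → P d r s t u ≡ true
exhaustive₅ P e d r s t = allᶜ-sound (P d r s t) (exhaustive₄ (λ d r s t → allᶜ (P d r s t)) e d r s t)

record Links (T : Arcs 3) (E X : Fin 3 → Bool) : Set where
  field
    entry⇝exit : ∀ {t s} → E t ≡ true → X s ≡ true → Reach T t s
    entry⇝     : ∀ t → ∃ λ s → E s ≡ true × Reach T s t
    ⇝exit      : ∀ t → ∃ λ s → X s ≡ true × Reach T t s

Links-cong : ∀ {T E E′ X X′} → (∀ t → E t ≡ E′ t) → (∀ t → X t ≡ X′ t) → Links T E X → Links T E′ X′
Links-cong E≗E′ X≗X′ L = record
  { entry⇝exit = λ e x → entry⇝exit (trans (E≗E′ _) e) (trans (X≗X′ _) x)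
  ; entry⇝     = λ t → let s , e , p = entry⇝ t in s , trans (sym (E≗E′ s)) e , p
  ; ⇝exit      = λ t → let s , x , p = ⇝exit t in s , trans (sym (X≗X′ s)) x , p
  }
  where open Links L

Links-along : ∀ {T T′ E X} → T′ ≡ T → Links T E X → Links T′ E X
Links-along refl L = L

reach₂? : Arcs 3 → Fin 3 → Fin 3 → Bool
reach₂? T t s = t == s ∨ T t s ∨ someᶜ (λ m → T t m ∧ T m s)

reach₂?-sound : ∀ T {t s} → reach₂? T t s ≡ true → Reach T t s
reach₂?-sound T {t} {s} e with t == s in t=s | T t s in ts
... | true  | _     = subst (Reach T t) (==⇒≡ t=s) here
... | false | true  = step ts here
... | false | false =
  let m , tms = someᶜ-sound (λ m → T t m ∧ T m s) e
  in  step (∧-conicalˡ (T t m) _ tms) (step (∧-conicalʳ (T t m) _ tms) here)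

links? : Arcs 3 → (Fin 3 → Bool) → (Fin 3 → Bool) → Bool
links? T E X =
  (allᶜ λ t → allᶜ λ s → E t ∧ X s ⇒ reach₂? T t s) ∧
  (allᶜ λ t → someᶜ λ s → E s ∧ reach₂? T s t) ∧
  (allᶜ λ t → someᶜ λ s → X s ∧ reach₂? T t s)

links?-sound : ∀ T E X → links? T E X ≡ true → Links T E X
links?-sound T E X e = record
  { entry⇝exit = λ {t} {s} et xs →
      reach₂?-sound T (⇒-mp (allᶜ-sound (C₁ t) (allᶜ-sound (λ t → allᶜ (C₁ t)) c₁ t) s) (∧-intro et xs))
  ; entry⇝     = λ t → let s , p = someᶜ-sound (λ s → E s ∧ reach₂? T s t) (allᶜ-sound C₂ c₂ t)
                       in  s , ∧-conicalˡ (E s) _ p , reach₂?-sound T (∧-conicalʳ (E s) _ p)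
  ; ⇝exit      = λ t → let s , p = someᶜ-sound (λ s → X s ∧ reach₂? T t s) (allᶜ-sound C₃ c₃ t)
                       in  s , ∧-conicalˡ (X s) _ p , reach₂?-sound T (∧-conicalʳ (X s) _ p)
  }
  where
  C₁ : Fin 3 → Fin 3 → Bool
  C₁ t s = E t ∧ X s ⇒ reach₂? T t s
  C₂ C₃ : Fin 3 → Bool
  C₂ t = someᶜ λ s → E s ∧ reach₂? T s t
  C₃ t = someᶜ λ s → X s ∧ reach₂? T t s
  c₁ : allᶜ (λ t → allᶜ (C₁ t)) ≡ true
  c₁ = ∧-conicalˡ _ _ e
  c₂ : allᶜ C₂ ≡ true
  c₂ = ∧-conicalˡ (allᶜ C₂) _ (∧-conicalʳ (allᶜ (λ t → allᶜ (C₁ t))) _ e)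
  c₃ : allᶜ C₃ ≡ true
  c₃ = ∧-conicalʳ (allᶜ C₂) _ (∧-conicalʳ (allᶜ (λ t → allᶜ (C₁ t))) _ e)

K₃ : Graph 3
K₃ t s = not (t == s)

K₃-≢ : ∀ {t s} → t ≢ s → K₃ t s ≡ true
K₃-≢ t≢s = cong not (==-≢ t≢s)

tournament? : Arcs 3 → Bool
tournament? T = allᶜ λ t → allᶜ λ s → (T t s ⇒ K₃ t s) ∧ (K₃ t s ⇒ T t s xor T s t)

tournament : (T : Arcs 3) → tournament? T ≡ true → Orientation K₃
tournament T e = record
  { arc     = T
  ; arc⊆G   = λ t s ts → ⇒-mp (∧-conicalˡ (T t s ⇒ K₃ t s) _ (valid t s)) ts
  ; exactly = λ t s k → xor-cases (⇒-mp (∧-conicalʳ (T t s ⇒ K₃ t s) _ (valid t s)) k)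
  }
  where
  valid : ∀ t s → (T t s ⇒ K₃ t s) ∧ (K₃ t s ⇒ T t s xor T s t) ≡ true
  valid t = allᶜ-sound _ (allᶜ-sound (λ t → allᶜ λ s → (T t s ⇒ K₃ t s) ∧ (K₃ t s ⇒ T t s xor T s t)) e t)
  xor-cases : ∀ {x y} → x xor y ≡ true → (x ≡ true × y ≡ false) ⊎ (x ≡ false × y ≡ true)
  xor-cases {true}  {false} _ = inj₁ (refl , refl)
  xor-cases {false} {true}  _ = inj₂ (refl , refl)

next prev : Fin 3 → Fin 3
next zero             = suc zero
next (suc zero)       = suc (suc zero)
next (suc (suc zero)) = zero
prev zero             = suc (suc zero)
prev (suc zero)       = zero
prev (suc (suc zero)) = suc zero

next-or-prev : ∀ {t r} → K₃ t r ≡ true → r ≡ next t ⊎ r ≡ prev t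
next-or-prev {zero}           {suc zero}       _ = inj₁ refl
next-or-prev {zero}           {suc (suc zero)} _ = inj₂ refl
next-or-prev {suc zero}       {zero}           _ = inj₂ refl
next-or-prev {suc zero}       {suc (suc zero)} _ = inj₁ refl
next-or-prev {suc (suc zero)} {zero}           _ = inj₁ refl
next-or-prev {suc (suc zero)} {suc zero}       _ = inj₂ refl
next-or-prev {suc (suc zero)} {suc (suc zero)} ()

third : Fin 3 → Fin 3 → Fin 3
third p q = if next p == q then prev p else next p

exits entries : Pattern → Fin 3 → Bool
exits d t   = lookup d t
entries d t = not (lookup d t)

without : Fin 3 → (Fin 3 → Bool) → Fin 3 → Bool
without r f t = not (t == r) ∧ f t

in-and-out : (Fin 3 → Bool) → (Fin 3 → Bool) → Bool
in-and-out E X = someᶜ E ∧ someᶜ X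

in-and-out-cong : ∀ {E E′ X X′} → (∀ t → E t ≡ E′ t) → (∀ t → X t ≡ X′ t) →
                  in-and-out E X ≡ in-and-out E′ X′
in-and-out-cong E≗E′ X≗X′ = cong₂ _∧_ (someᶜ-cong E≗E′) (someᶜ-cong X≗X′)

balanced : Pattern → Bool
balanced d = in-and-out (entries d) (exits d)

split : Pattern → Fin 3 → Bool
split d r = in-and-out (without r (entries d)) (without r (exits d))

minority majority : Pattern → Fin 3
minority (a ∷ b ∷ c ∷ []) = if a xor b then (if a xor c then zero else suc zero) else suc (suc zero)
majority d = next (minority d)

path : Fin 3 → Fin 3 → Fin 3 → Arcs 3
path a b c u w = u == a ∧ not (w == a) ∨ u == b ∧ w == c

cycle : (Fin 3 → Fin 3) → Arcs 3
cycle σ u w = w == σ u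

-- The transitive tournament with r in the middle, from the entry to the exit among the other two
-- corners (when r is split).
through : Pattern → Fin 3 → Arcs 3
through d r = if lookup d (next r) then path (prev r) r (next r) else path (next r) r (prev r)

cycleThrough : Fin 3 → Fin 3 → Arcs 3
cycleThrough x y = cycle (if y == next x then next else prev)

-- The directed triangle whose arc between t and m goes from the exit to the entry.
rotor : Pattern → Fin 3 → Fin 3 → Arcs 3
rotor d t m = if lookup d t then cycleThrough t m else cycleThrough m t

through⁺ : Pattern → Fin 3 → Orientation K₃
through⁺ d r = tournament (through d r) (exhaustive₂ (λ d r → tournament? (through d r)) refl d r)

rotor⁺ : Pattern → Fin 3 → Fin 3 → Orientation K₃
rotor⁺ d t m = tournament (rotor d t m) (exhaustive₃ (λ d t m → tournament? (rotor d t m)) refl d t m)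

balanced⇒split-majority : ∀ d → balanced d ≡ true → split d (majority d) ≡ true
balanced⇒split-majority d = ⇒-mp (exhaustive₁ (λ d → balanced d ⇒ split d (majority d)) refl d)

¬split-everywhere : ∀ d → split d zero ≡ true → split d (suc zero) ≡ true →
                    split d (suc (suc zero)) ≡ true → ⊥
¬split-everywhere d s₀ s₁ s₂
  with () ← trans (sym (exhaustive₁ (λ d → not (split d zero ∧ split d (suc zero) ∧ split d (suc (suc zero))))
                                    refl d))
                  (cong not (∧-intro s₀ (∧-intro s₁ s₂)))

third-avoids : ∀ d p q → K₃ p q ≡ true → delEdge K₃ (third p q) (minority d) p q ≡ true
third-avoids d p q =
  ⇒-mp (exhaustive₃ (λ d p q → K₃ p q ⇒ delEdge K₃ (third p q) (minority d) p q) refl d p q)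

through-old-links : ∀ d r → split d r ≡ true → Links (through d r) (entries d) (exits d)
through-old-links d r s = links?-sound _ _ _
  (⇒-mp (exhaustive₂ (λ d r → split d r ⇒ links? (through d r) (entries d) (exits d)) refl d r) s)

through-spoke-links : ∀ d r → split d r ≡ true →
  Links (through d r) (without r (entries d)) (without r (exits d))
through-spoke-links d r s = links?-sound _ _ _
  (⇒-mp (exhaustive₂ (λ d r → split d r ⇒
                              links? (through d r) (without r (entries d)) (without r (exits d))) refl d r) s)

through-rim-links : ∀ d r p q → split d r ≡ true → delEdge K₃ r (minority d) p q ≡ true →
  Links (delEdge (through d r) p q) (entries d) (exits d)
through-rim-links d r p q s k = links?-sound _ _ _
  (⇒-mp (exhaustive₄ (λ d r p q → split d r ∧ delEdge K₃ r (minority d) p q ⇒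
                                  links? (delEdge (through d r) p q) (entries d) (exits d)) refl d r p q)
        (∧-intro s k))

rotor-old-links : ∀ d t m → split d (next t) ≡ true → split d (prev t) ≡ true →
  Links (rotor d t m) (entries d) (exits d)
rotor-old-links d t m s₁ s₂ = links?-sound _ _ _
  (⇒-mp (exhaustive₃ (λ d t m → split d (next t) ∧ split d (prev t) ⇒
                                links? (rotor d t m) (entries d) (exits d)) refl d t m)
        (∧-intro s₁ s₂))

rotor-spoke-links : ∀ d t m o → split d (next t) ≡ true → split d (prev t) ≡ true → K₃ t o ≡ true →
  Links (rotor d t m) (without o (entries d)) (without o (exits d))
rotor-spoke-links d t m o s₁ s₂ k = links?-sound _ _ _
  (⇒-mp (exhaustive₄ (λ d t m o → split d (next t) ∧ split d (prev t) ∧ K₃ t o ⇒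
                                  links? (rotor d t m) (without o (entries d)) (without o (exits d)))
                     refl d t m o)
        (∧-intro s₁ (∧-intro s₂ k)))

rotor-rim-links : ∀ d t m p q → split d (next t) ≡ true → split d (prev t) ≡ true →
  K₃ p q ≡ true → delEdge K₃ t m p q ≡ false →
  Links (delEdge (rotor d t m) p q) (entries d) (exits d)
rotor-rim-links d t m p q s₁ s₂ k k′ = links?-sound _ _ _
  (⇒-mp (exhaustive₅ (λ d t m p q → split d (next t) ∧ split d (prev t) ∧ K₃ p q ∧ not (delEdge K₃ t m p q) ⇒
                                    links? (delEdge (rotor d t m) p q) (entries d) (exits d))
                     refl d t m p q)
        (∧-intro s₁ (∧-intro s₂ (∧-intro k (cong not k′)))))

-- The local cubic modification

module LocalCubicModification
  {n : ℕ} (G : Graph n) (simple : IsSimple G) (v : Fin n) (x : Fin 3 → Fin n)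
  (x-adjacent : ∀ t → G v (x t) ≡ true)
  (x-injective : ∀ {t s} → x t ≡ x s → t ≡ s)
  (neighbour : ∀ {w} → G v w ≡ true → ∃ λ t → w ≡ x t)
  where

  H : Graph (suc (suc n))
  H = localCubicMod G v (x zero) (x (suc zero)) (x (suc (suc zero)))

  adjacent-sym : ∀ {a b} → G a b ≡ true → G b a ≡ true
  adjacent-sym {a} {b} = trans (IsSimple.sym simple b a)

  x≢v : ∀ t → x t ≢ v
  x≢v t x≡v with () ← trans (sym (subst (λ w → G v w ≡ true) x≡v (x-adjacent t))) (IsSimple.loopless simple v)

  corner : Fin 3 → Fin (suc (suc n))
  corner zero             = suc (suc v)
  corner (suc zero)       = zero
  corner (suc (suc zero)) = suc zero

  -- The proof in old is irrelevant, so that vertex-old holds by refl for any proof of a ≢ v.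
  data Vertex : Fin (suc (suc n)) → Set where
    old : ∀ a → .(a ≢ v) → Vertex (suc (suc a))
    new : ∀ t → Vertex (corner t)

  recompute-≢ : ∀ {a} → .(a ≢ v) → a ≢ v
  recompute-≢ {a} = recompute (¬? (a ≟ v))

  vertex : ∀ p → Vertex p
  vertex zero          = new (suc zero)
  vertex (suc zero)    = new (suc (suc zero))
  vertex (suc (suc a)) with a ≟ v
  ... | yes refl = new zero
  ... | no a≢v   = old a a≢v

  vertex-old : ∀ {a} (a≢v : a ≢ v) → vertex (suc (suc a)) ≡ old a a≢v
  vertex-old {a} a≢v with a ≟ v
  ... | yes a≡v = ⊥-elim (a≢v a≡v)
  ... | no _    = refl

  vertex-new : ∀ t → vertex (corner t) ≡ new t
  vertex-new zero with v ≟ v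
  ... | yes refl = refl
  ... | no v≢v   = ⊥-elim (v≢v refl)
  vertex-new (suc zero)       = refl
  vertex-new (suc (suc zero)) = refl

  adjacentᵛ : ∀ {p q} → Vertex p → Vertex q → Bool
  adjacentᵛ (old a _) (old b _) = G a b
  adjacentᵛ (old a _) (new t)   = a == x t
  adjacentᵛ (new t)   (old b _) = b == x t
  adjacentᵛ (new t)   (new s)   = K₃ t s

  H-vertex : ∀ p q → H p q ≡ adjacentᵛ (vertex p) (vertex q)
  H-vertex zero          zero          = refl
  H-vertex zero          (suc zero)    = refl
  H-vertex (suc zero)    zero          = refl
  H-vertex (suc zero)    (suc zero)    = refl
  H-vertex zero          (suc (suc b)) with b ≟ v
  ... | yes refl = refl
  ... | no _     = refl
  H-vertex (suc zero)    (suc (suc b)) with b ≟ v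
  ... | yes refl = refl
  ... | no _     = refl
  H-vertex (suc (suc a)) zero          with a ≟ v
  ... | yes refl = refl
  ... | no _     = refl
  H-vertex (suc (suc a)) (suc zero)    with a ≟ v
  ... | yes refl = refl
  ... | no _     = refl
  H-vertex (suc (suc a)) (suc (suc b)) with a ≟ v | b ≟ v
  ... | yes refl | yes refl = refl
  ... | yes refl | no _     = refl
  ... | no _     | yes refl = refl
  ... | no _     | no _     = refl

  liftᵛ : Arcs n → Arcs 3 → ∀ {p q} → Vertex p → Vertex q → Bool
  liftᵛ A T (old a _) (old b _) = A a b
  liftᵛ A T (old a _) (new t)   = a == x t ∧ A a v
  liftᵛ A T (new t)   (old b _) = b == x t ∧ A v b
  liftᵛ A T (new t)   (new s)   = T t s

  liftArcs : Arcs n → Arcs 3 → Arcs (suc (suc n))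
  liftArcs A T p q = liftᵛ A T (vertex p) (vertex q)

  module _ {A : Arcs n} {T : Arcs 3} where

    liftArcs-old : ∀ {a b} → a ≢ v → b ≢ v → liftArcs A T (suc (suc a)) (suc (suc b)) ≡ A a b
    liftArcs-old a≢v b≢v = cong₂ (liftᵛ A T) (vertex-old a≢v) (vertex-old b≢v)

    liftArcs-in : ∀ t → liftArcs A T (suc (suc (x t))) (corner t) ≡ A (x t) v
    liftArcs-in t = trans (cong₂ (liftᵛ A T) (vertex-old (x≢v t)) (vertex-new t))
                          (cong (_∧ A (x t) v) (==-refl (x t)))

    liftArcs-out : ∀ t → liftArcs A T (corner t) (suc (suc (x t))) ≡ A v (x t)
    liftArcs-out t = trans (cong₂ (liftᵛ A T) (vertex-new t) (vertex-old (x≢v t)))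
                           (cong (_∧ A v (x t)) (==-refl (x t)))

    liftArcs-new : ∀ t s → liftArcs A T (corner t) (corner s) ≡ T t s
    liftArcs-new t s = cong₂ (liftᵛ A T) (vertex-new t) (vertex-new s)

  liftArcs-mono : ∀ {A A′ T T′} → A ⊆ᵃ A′ → T ⊆ᵃ T′ → liftArcs A T ⊆ᵃ liftArcs A′ T′
  liftArcs-mono {A} {A′} {T} {T′} A⊆A′ T⊆T′ p q = mono (vertex p) (vertex q)
    where
    mono : ∀ {p q} (y : Vertex p) (z : Vertex q) → liftᵛ A T y z ≡ true → liftᵛ A′ T′ y z ≡ true
    mono (old a _) (old b _) e = A⊆A′ a b e
    mono (old a _) (new t)   e = ∧-intro (∧-conicalˡ (a == x t) _ e) (A⊆A′ a v (∧-conicalʳ (a == x t) _ e))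
    mono (new t)   (old b _) e = ∧-intro (∧-conicalˡ (b == x t) _ e) (A⊆A′ v b (∧-conicalʳ (b == x t) _ e))
    mono (new t)   (new s)   e = T⊆T′ t s e

  lift : Orientation G → Orientation K₃ → Orientation H
  lift O τ = record
    { arc     = liftArcs (arc O) (arc τ)
    ; arc⊆G   = λ p q e → trans (H-vertex p q) (lifted⊆adjacent (vertex p) (vertex q) e)
    ; exactly = λ p q e → lifted-exactly (vertex p) (vertex q) (trans (sym (H-vertex p q)) e)
    }
    where
    lifted⊆adjacent : ∀ {p q} (y : Vertex p) (z : Vertex q) →
                      liftᵛ (arc O) (arc τ) y z ≡ true → adjacentᵛ y z ≡ true
    lifted⊆adjacent (old a _) (old b _) e = arc⊆G O a b e
    lifted⊆adjacent (old a _) (new t)   e = ∧-conicalˡ (a == x t) _ e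
    lifted⊆adjacent (new t)   (old b _) e = ∧-conicalˡ (b == x t) _ e
    lifted⊆adjacent (new t)   (new s)   e = arc⊆G τ t s e
    spoke : ∀ {a} t → (a == x t) ≡ true → G v a ≡ true
    spoke t e = subst (λ w → G v w ≡ true) (sym (==⇒≡ e)) (x-adjacent t)
    lifted-exactly : ∀ {p q} (y : Vertex p) (z : Vertex q) → adjacentᵛ y z ≡ true →
      let B = liftᵛ (arc O) (arc τ) in
      (B y z ≡ true × B z y ≡ false) ⊎ (B y z ≡ false × B z y ≡ true)
    lifted-exactly (old a _) (old b _) e = exactly O a b e
    lifted-exactly (old a _) (new t)   e rewrite e = exactly O a v (adjacent-sym (spoke t e))
    lifted-exactly (new t)   (old b _) e rewrite e = exactly O v b (spoke t e)
    lifted-exactly (new t)   (new s)   e = exactly τ t s e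

  inArcs outArcs : Arcs n → Fin 3 → Bool
  inArcs  A t = A (x t) v
  outArcs A t = A v (x t)

  in-and-out-at-v : ∀ A → A ⊆ᵃ G → StronglyConnected A → in-and-out (inArcs A) (outArcs A) ≡ true
  in-and-out-at-v A A⊆G strong = ∧-intro has-in has-out
    where
    has-in : someᶜ (inArcs A) ≡ true
    has-in with w , wv ← reach-arc-into (strong (x zero) v) (x≢v zero)
           with t , refl ← neighbour (adjacent-sym (A⊆G _ _ wv)) = someᶜ-intro (inArcs A) wv
    has-out : someᶜ (outArcs A) ≡ true
    has-out with w , vw ← reach-arc-out-of (strong v (x zero)) (x≢v zero ∘ sym)
            with t , refl ← neighbour (A⊆G _ _ vw) = someᶜ-intro (outArcs A) vw

  -- A path of A is lifted arc by arc; when it passes through v it enters the triangle at an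
  -- entry corner and leaves it at an exit corner.
  module Lifting (A : Arcs n) (T : Arcs 3) (A⊆G : A ⊆ᵃ G) (strong : StronglyConnected A)
                 (links : Links T (inArcs A) (outArcs A)) where
    open Links links

    B : Arcs (suc (suc n))
    B = liftArcs A T

    data Above : Fin (suc (suc n)) → Fin n → Set where
      old   : ∀ {a} → a ≢ v → Above (suc (suc a)) a
      entry : ∀ {t} → A (x t) v ≡ true → Above (corner t) v

    single : ∀ {p q} → B p q ≡ true → Reach B p q
    single e = step e here

    triangle : ∀ {t s} → Reach T t s → Reach B (corner t) (corner s)
    triangle = reach-map corner (λ {t} {s} e → trans (liftArcs-new {A = A} {T = T} t s) e)

    leave : ∀ {t s} → Reach T t s → A v (x s) ≡ true → Reach B (corner t) (suc (suc (x s)))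
    leave p e = reach-trans (triangle p) (single (trans (liftArcs-out {A = A} {T = T} _) e))

    step-above : ∀ {p a c} → Above p a → A a c ≡ true → ∃ λ q → Above q c × Reach B p q
    step-above {c = c} (old {a} a≢v) e with c ≟ v
    ... | no c≢v = _ , old c≢v , single (trans (liftArcs-old {A = A} {T = T} a≢v c≢v) e)
    ... | yes refl with t , refl ← neighbour (adjacent-sym (A⊆G _ _ e)) =
      _ , entry e , single (trans (liftArcs-in {A = A} {T = T} t) e)
    step-above (entry {t} e) e′ with s , refl ← neighbour (A⊆G _ _ e′) =
      _ , old (x≢v s) , leave (entry⇝exit e e′) e′

    lift-reach : ∀ {p a b} → Reach A a b → Above p a → ∃ λ q → Above q b × Reach B p q
    lift-reach here       above = _ , above , here
    lift-reach (step e r) above with q , above′ , p⇝q ← step-above above e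
                                with q′ , above″ , q⇝q′ ← lift-reach r above′ =
      q′ , above″ , reach-trans p⇝q q⇝q′

    above-old : ∀ {q b} → Above q b → b ≢ v → Reach B q (suc (suc b))
    above-old (old _)   _   = here
    above-old (entry _) v≢v = ⊥-elim (v≢v refl)

    start : ∀ p → ∃₂ λ a q → Above q a × Reach B p q
    start p with vertex p
    ... | old a a≢v = a , _ , old (recompute-≢ a≢v) , here
    ... | new t with s , e , t⇝s ← ⇝exit t = x s , _ , old (x≢v s) , leave t⇝s e

    strongly-connected : StronglyConnected B
    strongly-connected p r with a , q , above , p⇝q ← start p | vertex r
    ... | old b b≢v with q′ , above′ , q⇝q′ ← lift-reach (strong a b) above =
      reach-trans p⇝q (reach-trans q⇝q′ (above-old above′ (recompute-≢ b≢v)))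
    ... | new t with s , e , s⇝t ← entry⇝ t
                with q′ , above′ , q⇝q′ ← lift-reach (strong a (x s)) above =
      reach-trans p⇝q (reach-trans q⇝q′ (reach-trans (above-old above′ (x≢v s))
        (step (trans (liftArcs-in {A = A} {T = T} s) e) (triangle s⇝t))))

  -- Deleting an edge of the lifted orientation leaves a superset of the lift of the reduced one.
  deletable-by-lifting : ∀ (O : Orientation G) (τ : Orientation K₃) A T {p q} →
    A ⊆ᵃ arc O → T ⊆ᵃ arc τ → liftArcs A T p q ≡ false → liftArcs A T q p ≡ false →
    StronglyConnected A → Links T (inArcs A) (outArcs A) → Deletable (lift O τ) p q
  deletable-by-lifting O τ A T A⊆O T⊆τ pq∉ qp∉ strong links =
    strongly-connected-mono (delEdge-⊇ (liftArcs-mono A⊆O T⊆τ) pq∉ qp∉)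
      (Lifting.strongly-connected A T (⊆ᵃ-trans A⊆O (arc⊆G O)) strong links)

  directions : Orientation G → Pattern
  directions O = outArcs (arc O) zero ∷ outArcs (arc O) (suc zero) ∷ outArcs (arc O) (suc (suc zero)) ∷ []

  module Deletion (O : Orientation G) where
    private
      d : Pattern
      d = directions O

    exits-directions : ∀ t → exits d t ≡ outArcs (arc O) t
    exits-directions zero             = refl
    exits-directions (suc zero)       = refl
    exits-directions (suc (suc zero)) = refl

    entries-directions : ∀ t → entries d t ≡ inArcs (arc O) t
    entries-directions t with exactly O (x t) v (adjacent-sym (x-adjacent t)) | exits-directions t
    ... | inj₁ (into , out) | e = trans (cong not (trans e out)) (sym into)
    ... | inj₂ (into , out) | e = trans (cong not (trans e out)) (sym into)

    spoke-in : ∀ r t → without r (entries d) t ≡ inArcs (delEdge (arc O) (x r) v) t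
    spoke-in r t with t ≟ r
    ... | yes refl = sym (delEdge-deletes {A = arc O})
    ... | no t≢r   = trans (entries-directions t)
      (sym (delEdge-keeps {A = arc O} (λ (xt≡xr , _) → t≢r (x-injective xt≡xr))
                                      (λ (xt≡v , _) → x≢v t xt≡v)))

    spoke-out : ∀ r t → without r (exits d) t ≡ outArcs (delEdge (arc O) (x r) v) t
    spoke-out r t with t ≟ r
    ... | yes refl = sym (delEdge-deletes-reversed {A = arc O})
    ... | no t≢r   = trans (exits-directions t)
      (sym (delEdge-keeps {A = arc O} (λ (v≡xr , _) → x≢v r (sym v≡xr))
                                      (λ (_ , xt≡xr) → t≢r (x-injective xt≡xr))))

    balanced-directions : StronglyConnected (arc O) → balanced d ≡ true
    balanced-directions strong =
      trans (in-and-out-cong entries-directions exits-directions) (in-and-out-at-v (arc O) (arc⊆G O) strong)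

    split-directions : ∀ r → Deletable O (x r) v → split d r ≡ true
    split-directions r del =
      trans (in-and-out-cong (spoke-in r) (spoke-out r))
            (in-and-out-at-v _ (⊆ᵃ-trans delEdge-⊆ (arc⊆G O)) del)

    old-deletable : ∀ {a b} (τ : Orientation K₃) → a ≢ v → b ≢ v → Deletable O a b →
      Links (arc τ) (entries d) (exits d) → Deletable (lift O τ) (suc (suc a)) (suc (suc b))
    old-deletable {a} {b} τ a≢v b≢v del links =
      deletable-by-lifting O τ A′ (arc τ) delEdge-⊆ ⊆ᵃ-refl
        (trans (liftArcs-old a≢v b≢v) (delEdge-deletes {A = arc O}))
        (trans (liftArcs-old b≢v a≢v) (delEdge-deletes-reversed {A = arc O}))
        del (Links-cong in-arcs out-arcs links)
      where
      A′ = delEdge (arc O) a b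
      in-arcs : ∀ t → entries d t ≡ inArcs A′ t
      in-arcs t = trans (entries-directions t)
        (sym (delEdge-keeps {A = arc O} (b≢v ∘ sym ∘ proj₂) (a≢v ∘ sym ∘ proj₂)))
      out-arcs : ∀ t → exits d t ≡ outArcs A′ t
      out-arcs t = trans (exits-directions t)
        (sym (delEdge-keeps {A = arc O} (a≢v ∘ sym ∘ proj₁) (b≢v ∘ sym ∘ proj₁)))

    spoke-deletable : ∀ r (τ : Orientation K₃) → Deletable O (x r) v →
      Links (arc τ) (without r (entries d)) (without r (exits d)) →
      Deletable (lift O τ) (suc (suc (x r))) (corner r)
    spoke-deletable r τ del links =
      deletable-by-lifting O τ (delEdge (arc O) (x r) v) (arc τ) delEdge-⊆ ⊆ᵃ-refl
        (trans (liftArcs-in r) (delEdge-deletes {A = arc O}))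
        (trans (liftArcs-out r) (delEdge-deletes-reversed {A = arc O}))
        del (Links-cong (spoke-in r) (spoke-out r) links)

    rim-deletable : ∀ p q (τ : Orientation K₃) → StronglyConnected (arc O) →
      Links (delEdge (arc τ) p q) (entries d) (exits d) → Deletable (lift O τ) (corner p) (corner q)
    rim-deletable p q τ strong links =
      deletable-by-lifting O τ (arc O) (delEdge (arc τ) p q) ⊆ᵃ-refl delEdge-⊆
        (trans (liftArcs-new p q) (delEdge-deletes {A = arc τ}))
        (trans (liftArcs-new q p) (delEdge-deletes-reversed {A = arc τ}))
        strong (Links-cong entries-directions exits-directions links)

  module Assembly {k : ℕ} (Os : Fin k → Orientation G)
                  (covers : ∀ u w → G u w ≡ true → ∃ λ i → Deletable (Os i) u w) where

    d : Fin k → Pattern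
    d i = directions (Os i)

    spoke-index : Fin 3 → Fin k
    spoke-index r = proj₁ (covers (x r) v (adjacent-sym (x-adjacent r)))

    spoke-deletable-at : ∀ r → Deletable (Os (spoke-index r)) (x r) v
    spoke-deletable-at r = proj₂ (covers (x r) v (adjacent-sym (x-adjacent r)))

    strongly-connected-at : ∀ r → StronglyConnected (arc (Os (spoke-index r)))
    strongly-connected-at r = strongly-connected-mono delEdge-⊆ (spoke-deletable-at r)

    split-at : ∀ r → split (d (spoke-index r)) r ≡ true
    split-at r = Deletion.split-directions (Os (spoke-index r)) r (spoke-deletable-at r)

    record Plan : Set where
      field
        τ           : Fin k → Orientation K₃
        old-links   : ∀ i → balanced (d i) ≡ true → Links (arc (τ i)) (entries (d i)) (exits (d i))
        spoke-links : ∀ r → let i = spoke-index r in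
                      Links (arc (τ i)) (without r (entries (d i))) (without r (exits (d i)))
        rim-links   : ∀ p q → K₃ p q ≡ true → ∃ λ i → StronglyConnected (arc (Os i)) ×
                      Links (delEdge (arc (τ i)) p q) (entries (d i)) (exits (d i))

    assemble : Plan → Admits H k
    assemble plan =
      (λ i → lift (Os i) (τ i)) , λ p q e → cover (vertex p) (vertex q) (trans (sym (H-vertex p q)) e)
      where
      open Plan plan
      cover : ∀ {p q} (y : Vertex p) (z : Vertex q) → adjacentᵛ y z ≡ true →
              ∃ λ i → Deletable (lift (Os i) (τ i)) p q
      cover (old a a≢v) (old b b≢v) e with i , del ← covers a b e =
        i , Deletion.old-deletable (Os i) (τ i) (recompute-≢ a≢v) (recompute-≢ b≢v) del
              (old-links i (Deletion.balanced-directions (Os i) (strongly-connected-mono delEdge-⊆ del)))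
      cover (old a _) (new r) e with refl ← ==⇒≡ e =
        spoke-index r , Deletion.spoke-deletable (Os _) r (τ _) (spoke-deletable-at r) (spoke-links r)
      cover (new r) (old b _) e with refl ← ==⇒≡ e =
        spoke-index r , delEdge-strongly-connected-comm
          (Deletion.spoke-deletable (Os _) r (τ _) (spoke-deletable-at r) (spoke-links r))
      cover (new p) (new q) e with i , strong , links ← rim-links p q e =
        i , Deletion.rim-deletable (Os i) p q (τ i) strong links

    module Distinct (injective : ∀ {r s} → spoke-index r ≡ spoke-index s → r ≡ s) where

      role : Fin k → Fin 3
      role i with any? (λ r → spoke-index r ≟ i)
      ... | yes (r , _) = r
      ... | no _        = majority (d i)

      role-spoke-index : ∀ r → role (spoke-index r) ≡ r
      role-spoke-index r with any? (λ s → spoke-index s ≟ spoke-index r)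
      ... | yes (s , same) = injective same
      ... | no none        = ⊥-elim (none (r , refl))

      role-split : ∀ i → balanced (d i) ≡ true → split (d i) (role i) ≡ true
      role-split i bal with any? (λ r → spoke-index r ≟ i)
      ... | yes (r , refl) = split-at r
      ... | no _           = balanced⇒split-majority (d i) bal

      spoke-links : ∀ r → let i = spoke-index r in
        Links (through (d i) (role i)) (without r (entries (d i))) (without r (exits (d i)))
      spoke-links r rewrite role-spoke-index r = through-spoke-links (d (spoke-index r)) r (split-at r)

      rim-links : ∀ p q → K₃ p q ≡ true → let i = spoke-index (third p q) in
        Links (delEdge (through (d i) (role i)) p q) (entries (d i)) (exits (d i))
      rim-links p q pq rewrite role-spoke-index (third p q) =
        through-rim-links (d i) (third p q) p q (split-at (third p q)) (third-avoids (d i) p q pq)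
        where i = spoke-index (third p q)

      plan : Plan
      plan = record
        { τ           = λ i → through⁺ (d i) (role i)
        ; old-links   = λ i bal → through-old-links (d i) (role i) (role-split i bal)
        ; spoke-links = spoke-links
        ; rim-links   = λ p q pq →
                          spoke-index (third p q) , strongly-connected-at (third p q) , rim-links p q pq
        }

    -- No transitive tournament serves both spokes at j, but a directed triangle does; it is
    -- oriented so as to free the edge between t and m, the one not freed at spoke-index t.
    module Paired (t : Fin 3) (paired : spoke-index (next t) ≡ spoke-index (prev t))
                  (apart : spoke-index t ≢ spoke-index (next t)) where

      j : Fin k
      j = spoke-index (next t)

      m : Fin 3
      m = minority (d (spoke-index t))

      split-next : split (d j) (next t) ≡ true
      split-next = split-at (next t)

      split-prev : split (d j) (prev t) ≡ true
      split-prev = subst (λ i → split (d i) (prev t) ≡ true) (sym paired) (split-at (prev t))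

      role : Fin k → Fin 3
      role i = if i == spoke-index t then t else majority (d i)

      role-split : ∀ i → balanced (d i) ≡ true → split (d i) (role i) ≡ true
      role-split i bal with i ≟ spoke-index t
      ... | yes refl = split-at t
      ... | no _     = balanced⇒split-majority (d i) bal

      τ : Fin k → Orientation K₃
      τ i = if i == j then rotor⁺ (d i) t m else through⁺ (d i) (role i)

      τ-j : τ j ≡ rotor⁺ (d j) t m
      τ-j = cong (λ b → if b then rotor⁺ (d j) t m else through⁺ (d j) (role j)) (==-refl j)

      τ-other : ∀ {i} → i ≢ j → τ i ≡ through⁺ (d i) (role i)
      τ-other {i} i≢j = cong (λ b → if b then rotor⁺ (d i) t m else through⁺ (d i) (role i)) (==-≢ i≢j)

      τ-t : τ (spoke-index t) ≡ through⁺ (d (spoke-index t)) t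
      τ-t = trans (τ-other apart)
                  (cong (λ b → through⁺ (d (spoke-index t)) (if b then t else majority (d (spoke-index t))))
                        (==-refl (spoke-index t)))

      spoke-index-other : ∀ {r} → r ≢ t → spoke-index r ≡ j
      spoke-index-other r≢t with next-or-prev (K₃-≢ (r≢t ∘ sym))
      ... | inj₁ refl = refl
      ... | inj₂ refl = sym paired

      old-links : ∀ i → balanced (d i) ≡ true → Links (arc (τ i)) (entries (d i)) (exits (d i))
      old-links i bal = by-cases (i ≟ j)
        where
        by-cases : Dec (i ≡ j) → Links (arc (τ i)) (entries (d i)) (exits (d i))
        by-cases (yes i≡j) = subst (λ i → Links (arc (τ i)) (entries (d i)) (exits (d i))) (sym i≡j)
          (Links-along (cong arc τ-j) (rotor-old-links (d j) t m split-next split-prev))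
        by-cases (no i≢j)  = Links-along (cong arc (τ-other i≢j))
          (through-old-links (d i) (role i) (role-split i bal))

      spoke-links : ∀ r → let i = spoke-index r in
        Links (arc (τ i)) (without r (entries (d i))) (without r (exits (d i)))
      spoke-links r = by-cases (r ≟ t)
        where
        by-cases : Dec (r ≡ t) → let i = spoke-index r in
          Links (arc (τ i)) (without r (entries (d i))) (without r (exits (d i)))
        by-cases (yes refl) = Links-along (cong arc τ-t)
          (through-spoke-links (d (spoke-index t)) t (split-at t))
        by-cases (no r≢t)   =
          subst (λ i → Links (arc (τ i)) (without r (entries (d i))) (without r (exits (d i))))
                (sym (spoke-index-other r≢t))
                (Links-along (cong arc τ-j)
                  (rotor-spoke-links (d j) t m r split-next split-prev (K₃-≢ (r≢t ∘ sym))))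

      rim-links : ∀ p q → K₃ p q ≡ true → ∃ λ i → StronglyConnected (arc (Os i)) ×
        Links (delEdge (arc (τ i)) p q) (entries (d i)) (exits (d i))
      rim-links p q pq = by-cases (delEdge K₃ t m p q) refl
        where
        by-cases : ∀ b → delEdge K₃ t m p q ≡ b → ∃ λ i → StronglyConnected (arc (Os i)) ×
          Links (delEdge (arc (τ i)) p q) (entries (d i)) (exits (d i))
        by-cases true  kept = spoke-index t , strongly-connected-at t ,
          Links-along (cong (λ σ → delEdge (arc σ) p q) τ-t)
            (through-rim-links (d (spoke-index t)) t p q (split-at t) kept)
        by-cases false kept = j , strongly-connected-at (next t) ,
          Links-along (cong (λ σ → delEdge (arc σ) p q) τ-j)
            (rotor-rim-links (d j) t m p q split-next split-prev pq kept)

      plan : Plan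
      plan = record { τ = τ ; old-links = old-links ; spoke-links = spoke-links ; rim-links = rim-links }

    admits : Admits H k
    admits with spoke-index zero ≟ spoke-index (suc zero) | spoke-index zero ≟ spoke-index (suc (suc zero))
              | spoke-index (suc zero) ≟ spoke-index (suc (suc zero))
    ... | yes e₀₁ | yes e₀₂ | _ =
      ⊥-elim (¬split-everywhere (d (spoke-index zero)) (split-at zero)
               (subst (λ i → split (d i) (suc zero) ≡ true) (sym e₀₁) (split-at (suc zero)))
               (subst (λ i → split (d i) (suc (suc zero)) ≡ true) (sym e₀₂) (split-at (suc (suc zero)))))
    ... | yes e₀₁ | no n₀₂  | _       = assemble (Paired.plan (suc (suc zero)) e₀₁ (n₀₂ ∘ sym))
    ... | no n₀₁  | yes e₀₂ | _       =
      assemble (Paired.plan (suc zero) (sym e₀₂) (λ e₁₂ → n₀₁ (trans e₀₂ (sym e₁₂))))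
    ... | no n₀₁  | no _    | yes e₁₂ = assemble (Paired.plan zero e₁₂ n₀₁)
    ... | no n₀₁  | no n₀₂  | no n₁₂  = assemble (Distinct.plan (distinct⇒injective₃ spoke-index n₀₁ n₀₂ n₁₂))

lemma3p4 : ∀ {n} (G : Graph n) → IsSimple G → ThreeEdgeConnected G →
    (v x1 x2 x3 : Fin n) → degree G v ≡ 3 →
    G v x1 ≡ true → G v x2 ≡ true → G v x3 ≡ true →
    x1 ≢ x2 → x1 ≢ x3 → x2 ≢ x3 →
    (k k′ : ℕ) → IsFrankNumber G k →
    IsFrankNumber (localCubicMod G v x1 x2 x3) k′ → k′ ≤ k
lemma3p4 {n} G simple _ v x₁ x₂ x₃ deg g₁ g₂ g₃ x₁≢x₂ x₁≢x₃ x₂≢x₃ k k′ (G-admits , _) (_ , H-minimal) =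
  ≮⇒≥ λ k<k′ → H-minimal k k<k′ (Assembly.admits (proj₁ G-admits) (proj₂ G-admits))
  where
  x : Fin 3 → Fin n
  x = lookup (x₁ ∷ x₂ ∷ x₃ ∷ [])

  x-adjacent : ∀ t → G v (x t) ≡ true
  x-adjacent = lookup⁺ {P = λ w → G v w ≡ true} (g₁ ∷ g₂ ∷ g₃ ∷ [])

  open LocalCubicModification G simple v x x-adjacent (distinct⇒injective₃ x x₁≢x₂ x₁≢x₃ x₂≢x₃)
         (degree-3-neighbours G deg g₁ g₂ g₃ x₁≢x₂ x₁≢x₃ x₂≢x₃)
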